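{- Let $\mathcal{H}$ and $\mathcal{H}'$ be connected (multi)hypergraphs that have perfect colorings with the same incidence parameters $(V,W)$. That is, there are perfect colorings of $\mathcal{H}$ and of $\mathcal{H}'$ with the same color set $\{1,\dots,k\}$ and the same list $\gamma_1,\dots,\gamma_l$ of occurring color ranges, having the same matrices $V$ and $W$. Then there is a (multi)hypergraph $\mathcal{G}$ that covers both $\mathcal{H}$ and $\mathcal{H}'$.
   Context: A multihypergraph $(X,E)$ has a finite vertex set $X$ and a finite multiset $E$ of nonempty subsets of $X$ (hyperedges). It is connected if any two vertices are joined by a Berge path, i.e., an alternating sequence of vertices and hyperedges with consecutive elements incident. A coloring is a surjective map $f:X\to\{1,\dots,k\}$. The color range of a hyperedge $e$ is the multiset $f(e)=\{f(x):x\in e\}$. Let $\gamma_1,\dots,\gamma_l$ be the distinct color ranges that occur. The coloring is perfect if for all $i,j$ every vertex of color $i$ lies in the same number $v_{i,j}$ of hyperedges of color range $\gamma_j$. With $w_{j,i}$ the multiplicity of $i$ in $\gamma_j$, the pair $V=(v_{i,j})$ ($k\times l$), $W=(w_{j,i})$ ($l\times k$) is the incidence parameters of the coloring. A (multi)hypergraph $\mathcal{G}$ covers $\mathcal{H}$ if there are a surjective vertex map $\varphi$ and a hyperedge map $\psi$ with the following properties: - for every hyperedge $e$ of $\mathcal{G}$, $\varphi$ is injective on $e$ and $\varphi(e)$ is the vertex set of the hyperedge $\psi(e)$ of $\mathcal{H}$; - for every vertex $x$ of $\mathcal{G}$, $\psi$ restricts to a bijection from the hyperedges containing $x$ onto the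 hyperedges containing $\varphi(x)$. -}

module Defs where

open import Data.Nat using (ℕ; zero; suc)
open import Data.Fin using (Fin; zero; suc)
open import Data.Fin.Properties using (_≟_)
open import Data.Fin.Subset using (Subset; _∈_; Nonempty)
open import Data.Fin.Subset.Properties using (_∈?_)
open import Data.Vec using (Vec; tabulate)
import Data.Vec.Properties
import Data.Nat
open import Data.Product using (Σ; ∃; _×_; _,_)
open import Relation.Nullary using (Dec; yes; no; ¬_)
open import Relation.Nullary.Decidable using (_×-dec_)
open import Relation.Binary.PropositionalEquality using (_≡_)
open import Function.Definitions using (Injective; Surjective)

count : ∀ {n} {P : Fin n → Set} → (∀ x → Dec (P x)) → ℕ
count {zero} d = 0
count {suc n} d with d zero
... | yes _ = suc (count (λ x → d (suc x)))
... | no _ = count (λ x → d (suc x))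

-- A finite multihypergraph: vertices Fin nV, a family (multiset) of nE
-- hyperedges, each a nonempty subset of the vertices.
record Hypergraph : Set where
  field
    nV    : ℕ
    nE    : ℕ
    edge  : Fin nE → Subset nV
    edge≢∅ : ∀ e → Nonempty (edge e)
open Hypergraph public

data Reach (H : Hypergraph) : Fin (nV H) → Fin (nV H) → Set where
  here : ∀ {x} → Reach H x x
  step : ∀ {x y z} (e : Fin (nE H)) → x ∈ edge H e → y ∈ edge H e →
         Reach H y z → Reach H x z

Connected : Hypergraph → Set
Connected H = ∀ x y → Reach H x y

-- color range of hyperedge e under f, as the multiplicity vector (entry i =
-- multiplicity of color i in the multiset f(e))
colorRange : (H : Hypergraph) {k : ℕ} → (Fin (nV H) → Fin k) → Fin (nE H) → Vec ℕ k
colorRange H f e = tabulate λ i → count (λ x → (x ∈? edge H e) ×-dec (f x ≟ i))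

-- Perfect coloring of H with colors Fin k, distinct occurring color ranges
-- γ_1..γ_l given by W (γ_j has multiplicity W j i of color i), and matrix V.
record PerfectColoring (H : Hypergraph) (k l : ℕ)
       (V : Fin k → Fin l → ℕ) (W : Fin l → Fin k → ℕ) : Set where
  γ : Fin l → Vec ℕ k
  γ j = tabulate (W j)
  field
    f          : Fin (nV H) → Fin k
    surj       : Surjective _≡_ _≡_ f
    γ-distinct : Injective _≡_ _≡_ γ
    γ-occurs   : ∀ j → ∃ λ e → colorRange H f e ≡ γ j
    γ-complete : ∀ e → ∃ λ j → colorRange H f e ≡ γ j
    perfect    : ∀ i j x → f x ≡ i →
                 count (λ e → (x ∈? edge H e) ×-dec (Data.Vec.Properties.≡-dec Data.Nat._≟_ (colorRange H f e) (γ j)))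
                   ≡ V i j

record Covers (G H : Hypergraph) : Set where
  field
    φ        : Fin (nV G) → Fin (nV H)
    ψ        : Fin (nE G) → Fin (nE H)
    φ-surj   : Surjective _≡_ _≡_ φ
    φ-inj-on : ∀ e x y → x ∈ edge G e → y ∈ edge G e → φ x ≡ φ y → x ≡ y
    φ-image₁ : ∀ e x → x ∈ edge G e → φ x ∈ edge H (ψ e)
    φ-image₂ : ∀ e y → y ∈ edge H (ψ e) → ∃ λ x → x ∈ edge G e × φ x ≡ y
    ψ-inj-at : ∀ x e₁ e₂ → x ∈ edge G e₁ → x ∈ edge G e₂ → ψ e₁ ≡ ψ e₂ → e₁ ≡ e₂
    ψ-surj-at : ∀ x e′ → φ x ∈ edge H e′ → ∃ λ e → x ∈ edge G e × ψ e ≡ e′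

-- In H and in H′ a vertex of colour i lies on exactly V i j edges of range γⱼ and an edge of range γⱼ
-- contains exactly W j i vertices of colour i, so the edges of range j at a vertex can be numbered
-- 0, …, V i j − 1 and the vertices of colour i on an edge 0, …, W j i − 1 (edgeRank, vertexRank).
--
-- The vertices of the common cover G are pairs (x′, ω) and its edges pairs (e′, ω), with x′, e′ in H′
-- and ω a state: a vertex of H of each colour i, an edge of H of each range j, and for each (i, j) a
-- residue modulo V i j and one modulo W j i.  For x′ of colour i and e′ of range j, (x′, ω) lies on
-- (e′, ω′) when x′ ∈ e′, the two states differ only in their (i, j)-data, the vertex x of ω lies on the
-- edge e of ω′, and the numberings match up to the residues: the number of e at x plus the residue of ω
-- is that of e′ at x′ modulo V i j, and likewise on the edge side with the residue of ω′ modulo W j i.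
-- The remaining (i, j)-entries of each state record the other state's vertex (respectively edge) by its
-- number, so either end of an incidence determines the other.  Forgetting ω maps G onto H′, reading off
-- the chosen vertex and edge maps G onto H, and since residues can be solved for uniquely both maps are
-- bijective on every star: they are coverings.

module Submission where

open import Defs
open import Data.Bool using (true; if_then_else_)
open import Data.Empty using (⊥; ⊥-elim)
open import Data.Fin using (Fin; zero; suc; toℕ; fromℕ<)
open import Data.Fin.Properties using (_≟_; all?; toℕ-injective; toℕ<n; toℕ-fromℕ<; *↔×)
open import Data.Fin.Subset using (_∈_)
open import Data.Fin.Subset.Properties using (_∈?_)
open import Data.Nat using (ℕ; zero; suc; pred; _+_; _*_; _∸_; _≤_; _<_; _≤?_; _<?_; z≤n; s≤s; >-nonZero)
import Data.Nat as ℕ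
open import Data.Nat.Properties
  using (m≤n⇒m≤1+n; 0≢1+n; suc-injective; +-comm; +-assoc; +-cancelˡ-≡; +-cancelʳ-≡; <⇒≱; m≤n+m;
         ≤-trans; <⇒≤; ≮⇒≥; ≰⇒>; ≤-<-trans; m∸n≤m; +-mono-<; +-monoˡ-<; m∸n+n≡m; m+n∸m≡n;
         m<n+o⇒m∸n<o; ∸-monoˡ-<; <⇒≤pred)
open import Data.Product using (∃; _×_; _,_; proj₁; proj₂)
open import Data.Product.Function.NonDependent.Propositional using (_×-↔_)
open import Data.Vec using (Vec; []; _∷_; lookup; tabulate; replicate; _[_]≔_)
open import Data.Vec.Properties
  using ([]=⇒lookup; lookup⇒[]=; lookup∘update; lookup∘update′; []≔-lookup; []≔-idempotent;
         lookup∘tabulate; lookup-replicate)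
import Data.Vec.Properties as Vec
open import Function using (_∘_)
open import Function.Bundles using (Inverse; _↔_; mk↔ₛ′)
open import Function.Properties.Inverse using (↔-refl; ↔-sym; ↔-trans)
open import Function.Definitions using (Injective)
open import Relation.Binary using (DecidableEquality)
open import Relation.Binary.PropositionalEquality
open import Relation.Nullary using (Dec; yes; no; does)
open import Relation.Nullary.Decidable using (map′; _×-dec_; dec-true)

private
  variable
    n k l : ℕ
    A : Set

-- Counting and ranking in Fin n

bump : Dec A → ℕ → ℕ
bump A? r = if does A? then suc r else r

count-suc : {P : Fin (suc n) → Set} (P? : ∀ x → Dec (P x)) →
            count P? ≡ bump (P? zero) (count (P? ∘ suc))
count-suc P? with P? zero
... | yes _ = refl
... | no _ = refl

count≤ : {P : Fin n → Set} (P? : ∀ x → Dec (P x)) → count P? ≤ n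
count≤ {zero} P? = z≤n
count≤ {suc n} P? rewrite count-suc P? with P? zero
... | yes _ = s≤s (count≤ (P? ∘ suc))
... | no _ = m≤n⇒m≤1+n (count≤ (P? ∘ suc))

rank : {P : Fin n → Set} → (∀ x → Dec (P x)) → Fin n → ℕ
rank P? zero = 0
rank P? (suc x) = bump (P? zero) (rank (P? ∘ suc) x)

rank<count : {P : Fin n → Set} (P? : ∀ x → Dec (P x)) {x : Fin n} → P x → rank P? x < count P?
rank<count {suc n} P? {zero} px rewrite count-suc P? with P? zero
... | yes _ = s≤s z≤n
... | no ¬p = ⊥-elim (¬p px)
rank<count {suc n} P? {suc x} px rewrite count-suc P? with P? zero
... | yes _ = s≤s (rank<count (P? ∘ suc) px)
... | no _ = rank<count (P? ∘ suc) px

rank-injective : {P : Fin n → Set} (P? : ∀ x → Dec (P x)) {x y : Fin n} → P x → P y →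
                 rank P? x ≡ rank P? y → x ≡ y
rank-injective P? {zero} {zero} px py eq = refl
rank-injective P? {zero} {suc y} px py eq with P? zero
... | yes _ = ⊥-elim (0≢1+n eq)
... | no ¬p = ⊥-elim (¬p px)
rank-injective P? {suc x} {zero} px py eq with P? zero
... | yes _ = ⊥-elim (0≢1+n (sym eq))
... | no ¬p = ⊥-elim (¬p py)
rank-injective P? {suc x} {suc y} px py eq with P? zero
... | yes _ = cong suc (rank-injective (P? ∘ suc) px py (suc-injective eq))
... | no _ = cong suc (rank-injective (P? ∘ suc) px py eq)

rank-surjective : {P : Fin n → Set} (P? : ∀ x → Dec (P x)) {r : ℕ} → r < count P? →
                  ∃ λ x → P x × rank P? x ≡ r
rank-surjective {suc n} P? {r} r< rewrite count-suc P? with P? zero in eq | r | r<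
... | yes p | zero | _ = zero , p , refl
... | yes _ | suc r | s≤s r< =
  let x , px , rank≡r = rank-surjective (P? ∘ suc) r<
  in suc x , px , trans (cong (λ d → bump d (rank (P? ∘ suc) x)) eq) (cong suc rank≡r)
... | no _ | r | r< =
  let x , px , rank≡r = rank-surjective (P? ∘ suc) r<
  in suc x , px , trans (cong (λ d → bump d (rank (P? ∘ suc) x)) eq) rank≡r

-- Finite types and enumerations

Finite : Set → Set
Finite A = ∃ λ N → A ↔ Fin N

Fin-finite : Finite (Fin n)
Fin-finite {n} = n , ↔-refl

×-finite : {B : Set} → Finite A → Finite B → Finite (A × B)
×-finite (a , A↔) (b , B↔) = a * b , ↔-trans (A↔ ×-↔ B↔) (↔-sym *↔×)

Vec-finite : Finite A → ∀ k → Finite (Vec A k)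
Vec-finite (a , A↔) zero = 1 , mk↔ₛ′ (λ _ → zero) (λ _ → []) (λ { zero → refl }) (λ { [] → refl })
Vec-finite {A} (a , A↔) (suc k) =
  let N , Vec↔ = Vec-finite (a , A↔) k in a * N , ↔-trans uncons (↔-trans (A↔ ×-↔ Vec↔) (↔-sym *↔×))
  where
  uncons : Vec A (suc k) ↔ (A × Vec A k)
  uncons = mk↔ₛ′ (λ { (x ∷ xs) → x , xs }) (λ (x , xs) → x ∷ xs) (λ _ → refl) (λ { (_ ∷ _) → refl })

finite⇒≡-dec : Finite A → DecidableEquality A
finite⇒≡-dec (N , A↔) x y = map′ to-injective (cong to) (to x ≟ to y)
  where
  open Inverse A↔
  to-injective : to x ≡ to y → x ≡ y
  to-injective eq = trans (sym (strictlyInverseʳ x)) (trans (cong from eq) (strictlyInverseʳ y))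

record Enumeration {A : Set} (P : A → Set) : Set where
  field
    size            : ℕ
    elem            : Fin size → A
    elem-satisfies  : ∀ c → P (elem c)
    elem-injective  : Injective _≡_ _≡_ elem
    elem-surjective : ∀ {a} → P a → ∃ λ c → elem c ≡ a

enumerate : Finite A → {P : A → Set} → (∀ a → Dec (P a)) → Enumeration P
enumerate (N , A↔) {P} P? = record
  { size = count Q?
  ; elem = from ∘ pick
  ; elem-satisfies = λ c → proj₁ (proj₂ (pick-spec c))
  ; elem-injective = pick-injective ∘ from-injective
  ; elem-surjective = hit
  }
  where
  open Inverse A↔
  Q? : ∀ c → Dec (P (from c))
  Q? c = P? (from c)
  pick-spec : ∀ c → ∃ λ c′ → P (from c′) × rank Q? c′ ≡ toℕ c
  pick-spec c = rank-surjective Q? (toℕ<n c)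
  pick : Fin (count Q?) → Fin N
  pick c = proj₁ (pick-spec c)
  from-injective : ∀ {c₁ c₂} → from c₁ ≡ from c₂ → c₁ ≡ c₂
  from-injective {c₁} {c₂} eq = trans (sym (strictlyInverseˡ c₁)) (trans (cong to eq) (strictlyInverseˡ c₂))
  pick-injective : ∀ {c₁ c₂} → pick c₁ ≡ pick c₂ → c₁ ≡ c₂
  pick-injective {c₁} {c₂} eq =
    toℕ-injective (trans (sym (proj₂ (proj₂ (pick-spec c₁))))
                         (trans (cong (rank Q?) eq) (proj₂ (proj₂ (pick-spec c₂)))))
  hit : ∀ {a} → P a → ∃ λ c → from (pick c) ≡ a
  hit {a} pa = c , trans (cong from pick≡) (strictlyInverseʳ a)
    where
    qa : P (from (to a))
    qa = subst P (sym (strictlyInverseʳ a)) pa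
    c = fromℕ< (rank<count Q? qa)
    pick≡ : pick c ≡ to a
    pick≡ = rank-injective Q? (proj₁ (proj₂ (pick-spec c))) qa
              (trans (proj₂ (proj₂ (pick-spec c))) (toℕ-fromℕ< (rank<count Q? qa)))

-- p + s ≡ q modulo N, for residues p, s, q < N.
data AddMod (N p s q : ℕ) : Set where
  exact : p + s ≡ q → AddMod N p s q
  wrap  : p + s ≡ q + N → AddMod N p s q

addMod? : ∀ N p s q → Dec (AddMod N p s q)
addMod? N p s q with p + s ℕ.≟ q | p + s ℕ.≟ q + N
... | yes eq | _      = yes (exact eq)
... | no ¬eq | yes eq = yes (wrap eq)
... | no ¬e₁ | no ¬e₂ = no λ { (exact e₁) → ¬e₁ e₁ ; (wrap e₂) → ¬e₂ e₂ }

module _ {N : ℕ} where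

  private
    overflow : ∀ {a b} → a < N → a ≡ b + N → ⊥
    overflow {b = b} a<N refl = <⇒≱ a<N (m≤n+m N b)

  addMod-comm : ∀ {p s q} → AddMod N p s q → AddMod N s p q
  addMod-comm {p} {s} (exact eq) = exact (trans (+-comm s p) eq)
  addMod-comm {p} {s} (wrap eq)  = wrap (trans (+-comm s p) eq)

  addMod-sum-unique : ∀ {p s q₁ q₂} → q₁ < N → q₂ < N →
                      AddMod N p s q₁ → AddMod N p s q₂ → q₁ ≡ q₂
  addMod-sum-unique _ _ (exact e₁) (exact e₂) = trans (sym e₁) e₂
  addMod-sum-unique q₁<N _ (exact e₁) (wrap e₂) = ⊥-elim (overflow q₁<N (trans (sym e₁) e₂))
  addMod-sum-unique _ q₂<N (wrap e₁) (exact e₂) = ⊥-elim (overflow q₂<N (trans (sym e₂) e₁))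
  addMod-sum-unique _ _ (wrap e₁) (wrap e₂) = +-cancelʳ-≡ _ _ _ (trans (sym e₁) e₂)

  addMod-right-unique : ∀ {p s₁ s₂ q} → s₁ < N → s₂ < N →
                        AddMod N p s₁ q → AddMod N p s₂ q → s₁ ≡ s₂
  addMod-right-unique {p} _ _ (exact e₁) (exact e₂) = +-cancelˡ-≡ p _ _ (trans e₁ (sym e₂))
  addMod-right-unique {p} _ s₂<N (exact e₁) (wrap e₂) =
    ⊥-elim (overflow s₂<N (+-cancelˡ-≡ p _ _ (trans e₂ (trans (cong (_+ N) (sym e₁)) (+-assoc p _ N)))))
  addMod-right-unique {p} s₁<N _ (wrap e₁) (exact e₂) =
    ⊥-elim (overflow s₁<N (+-cancelˡ-≡ p _ _ (trans e₁ (trans (cong (_+ N) (sym e₂)) (+-assoc p _ N)))))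
  addMod-right-unique {p} _ _ (wrap e₁) (wrap e₂) = +-cancelˡ-≡ p _ _ (trans e₁ (sym e₂))

  addMod-left-unique : ∀ {p₁ p₂ s q} → p₁ < N → p₂ < N →
                       AddMod N p₁ s q → AddMod N p₂ s q → p₁ ≡ p₂
  addMod-left-unique p₁<N p₂<N e₁ e₂ = addMod-right-unique p₁<N p₂<N (addMod-comm e₁) (addMod-comm e₂)

  addMod-sum : ∀ {p s} → p < N → s < N → ∃ λ q → q < N × AddMod N p s q
  addMod-sum {p} {s} p<N s<N with p + s <? N
  ... | yes p+s<N = p + s , p+s<N , exact refl
  ... | no p+s≮N =
    p + s ∸ N , m<n+o⇒m∸n<o (p + s) N {{>-nonZero (≤-<-trans z≤n p<N)}} (+-mono-< p<N s<N) ,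
    wrap (sym (m∸n+n≡m (≮⇒≥ p+s≮N)))

  addMod-left : ∀ {s q} → s < N → q < N → ∃ λ p → p < N × AddMod N p s q
  addMod-left {s} {q} s<N q<N with s ≤? q
  ... | yes s≤q = q ∸ s , ≤-<-trans (m∸n≤m q s) q<N , exact (m∸n+n≡m s≤q)
  ... | no s≰q = q + N ∸ s , q+N∸s<N , wrap (m∸n+n≡m s≤q+N)
    where
    s≤q+N : s ≤ q + N
    s≤q+N = ≤-trans (<⇒≤ s<N) (m≤n+m N q)
    q+N∸s<N : q + N ∸ s < N
    q+N∸s<N = subst (q + N ∸ s <_) (m+n∸m≡n s N) (∸-monoˡ-< (+-monoˡ-< N (≰⇒> s≰q)) s≤q+N)

  addMod-right : ∀ {p q} → p < N → q < N → ∃ λ s → s < N × AddMod N p s q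
  addMod-right p<N q<N = let s , s<N , e = addMod-left p<N q<N in s , s<N , addMod-comm e

-- Vectors and matrices with one entry updated

update-preserves : {P : Fin n → A → Set} (xs : Vec A n) → (∀ i → P i (lookup xs i)) →
                   ∀ {i x} → P i x → ∀ i′ → P i′ (lookup (xs [ i ]≔ x) i′)
update-preserves {P = P} xs all-P {i} {x} px i′ with i′ ≟ i
... | yes refl = subst (P i) (sym (lookup∘update i xs x)) px
... | no i′≢i = subst (P i′) (sym (lookup∘update′ i′≢i xs x)) (all-P i′)

Matrix : Set → ℕ → ℕ → Set
Matrix A k l = Vec (Vec A l) k

infix  30 _⟦_,_⟧
infixl 20 _⟦_,_⟧≔_

_⟦_,_⟧ : Matrix A k l → Fin k → Fin l → A
M ⟦ i , j ⟧ = lookup (lookup M i) j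

_⟦_,_⟧≔_ : Matrix A k l → Fin k → Fin l → A → Matrix A k l
M ⟦ i , j ⟧≔ a = M [ i ]≔ (lookup M i [ j ]≔ a)

module _ (M : Matrix A k l) (i : Fin k) (j : Fin l) where

  lookup∘update₂ : ∀ a → (M ⟦ i , j ⟧≔ a) ⟦ i , j ⟧ ≡ a
  lookup∘update₂ a =
    trans (cong (λ row → lookup row j) (lookup∘update i M _)) (lookup∘update j (lookup M i) a)

  []≔-lookup₂ : M ⟦ i , j ⟧≔ (M ⟦ i , j ⟧) ≡ M
  []≔-lookup₂ = trans (cong (M [ i ]≔_) ([]≔-lookup (lookup M i) j)) ([]≔-lookup M i)

  []≔-idempotent₂ : ∀ a b → (M ⟦ i , j ⟧≔ a) ⟦ i , j ⟧≔ b ≡ M ⟦ i , j ⟧≔ b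
  []≔-idempotent₂ a b = begin
    (M [ i ]≔ row a) [ i ]≔ (lookup (M [ i ]≔ row a) i [ j ]≔ b)
      ≡⟨ cong (λ r → (M [ i ]≔ row a) [ i ]≔ (r [ j ]≔ b)) (lookup∘update i M _) ⟩
    (M [ i ]≔ row a) [ i ]≔ (row a [ j ]≔ b)
      ≡⟨ []≔-idempotent M i ⟩
    M [ i ]≔ (row a [ j ]≔ b)
      ≡⟨ cong (M [ i ]≔_) ([]≔-idempotent (lookup M i) j) ⟩
    M [ i ]≔ row b
      ∎
    where
    open ≡-Reasoning
    row : A → Vec A l
    row c = lookup M i [ j ]≔ c

update-preserves₂ : {P : Fin k → Fin l → A → Set} (M : Matrix A k l) → (∀ i j → P i j (M ⟦ i , j ⟧)) →
                    ∀ {i j a} → P i j a → ∀ i′ j′ → P i′ j′ ((M ⟦ i , j ⟧≔ a) ⟦ i′ , j′ ⟧)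
update-preserves₂ {P = P} M all-P {i} {j} pa =
  update-preserves {P = λ i′ row → ∀ j′ → P i′ j′ (lookup row j′)} M all-P
    (update-preserves {P = P i} (lookup M i) (all-P i) pa)

cong₄ : {B C D R : Set} (f : A → B → C → D → R) {a a′ : A} {b b′ : B} {c c′ : C} {d d′ : D} →
        a ≡ a′ → b ≡ b′ → c ≡ c′ → d ≡ d′ → f a b c d ≡ f a′ b′ c′ d′
cong₄ f refl refl refl refl = refl

module States (X E S T : Set) (k l : ℕ) where

  record Local : Set where
    constructor local
    field
      vertex      : X
      hyperedge   : E
      vertexShift : S
      edgeShift   : T

  record State : Set where
    constructor state
    field
      vertices     : Vec X k
      hyperedges   : Vec E l
      vertexShifts : Matrix S k l
      edgeShifts   : Matrix T k l
  open Local public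
  open State public

  infix  30 _⟨_,_⟩
  infixl 20 _⟨_,_⟩≔_

  _⟨_,_⟩ : State → Fin k → Fin l → Local
  state xs es vs ts ⟨ i , j ⟩ = local (lookup xs i) (lookup es j) (vs ⟦ i , j ⟧) (ts ⟦ i , j ⟧)

  _⟨_,_⟩≔_ : State → Fin k → Fin l → Local → State
  state xs es vs ts ⟨ i , j ⟩≔ local x e v t =
    state (xs [ i ]≔ x) (es [ j ]≔ e) (vs ⟦ i , j ⟧≔ v) (ts ⟦ i , j ⟧≔ t)

  module _ (i : Fin k) (j : Fin l) where

    local∘update : ∀ ω c → (ω ⟨ i , j ⟩≔ c) ⟨ i , j ⟩ ≡ c
    local∘update (state xs es vs ts) (local x e v t) =
      cong₄ local (lookup∘update i xs x) (lookup∘update j es e)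
                  (lookup∘update₂ vs i j v) (lookup∘update₂ ts i j t)

    update∘local : ∀ ω → ω ⟨ i , j ⟩≔ (ω ⟨ i , j ⟩) ≡ ω
    update∘local (state xs es vs ts) =
      cong₄ state ([]≔-lookup xs i) ([]≔-lookup es j) ([]≔-lookup₂ vs i j) ([]≔-lookup₂ ts i j)

    update∘update : ∀ ω c d → (ω ⟨ i , j ⟩≔ c) ⟨ i , j ⟩≔ d ≡ ω ⟨ i , j ⟩≔ d
    update∘update (state xs es vs ts) (local _ _ _ _) (local x e v t) =
      cong₄ state ([]≔-idempotent xs i) ([]≔-idempotent es j)
                  ([]≔-idempotent₂ vs i j _ v) ([]≔-idempotent₂ ts i j _ t)

    Adjacent : State → State → Set
    Adjacent ω ω′ = ω′ ≡ ω ⟨ i , j ⟩≔ ω′ ⟨ i , j ⟩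

    adjacent-update : ∀ ω c → Adjacent ω (ω ⟨ i , j ⟩≔ c)
    adjacent-update ω c = cong (ω ⟨ i , j ⟩≔_) (sym (local∘update ω c))

    adjacent-sym : ∀ {ω ω′} → Adjacent ω ω′ → Adjacent ω′ ω
    adjacent-sym {ω} {ω′} ω~ω′ = begin
      ω                                                 ≡⟨ update∘local ω ⟨
      ω ⟨ i , j ⟩≔ ω ⟨ i , j ⟩                           ≡⟨ update∘update ω (ω′ ⟨ i , j ⟩) _ ⟨
      (ω ⟨ i , j ⟩≔ ω′ ⟨ i , j ⟩) ⟨ i , j ⟩≔ ω ⟨ i , j ⟩ ≡⟨ cong (_⟨ i , j ⟩≔ ω ⟨ i , j ⟩) ω~ω′ ⟨
      ω′ ⟨ i , j ⟩≔ ω ⟨ i , j ⟩                          ∎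
      where open ≡-Reasoning

    adjacent-unique : ∀ {ω ω₁ ω₂} → Adjacent ω ω₁ → Adjacent ω ω₂ →
                      ω₁ ⟨ i , j ⟩ ≡ ω₂ ⟨ i , j ⟩ → ω₁ ≡ ω₂
    adjacent-unique {ω} ω~ω₁ ω~ω₂ eq = trans ω~ω₁ (trans (cong (ω ⟨ i , j ⟩≔_) eq) (sym ω~ω₂))

  State-finite : Finite X → Finite E → Finite S → Finite T → Finite State
  State-finite X-fin E-fin S-fin T-fin =
    let N , State↔ = ×-finite (Vec-finite X-fin k) (×-finite (Vec-finite E-fin l)
                       (×-finite (Vec-finite (Vec-finite S-fin l) k) (Vec-finite (Vec-finite T-fin l) k)))
    in N , ↔-trans (mk↔ₛ′ (λ (state xs es vs ts) → xs , es , vs , ts)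
                          (λ (xs , es , vs , ts) → state xs es vs ts) (λ _ → refl) (λ _ → refl))
                   State↔

module _ {P : Fin n → Set} (P? : ∀ x → Dec (P x)) where

  private
    witness : ∀ {x} → does (P? x) ≡ true → P x
    witness {x} holds with P? x | holds
    ... | yes px | _ = px

  ∈-tabulate⁺ : ∀ {x} → P x → x ∈ tabulate (does ∘ P?)
  ∈-tabulate⁺ {x} px = lookup⇒[]= x _ (trans (lookup∘tabulate (does ∘ P?) x) (dec-true (P? x) px))

  ∈-tabulate⁻ : ∀ {x} → x ∈ tabulate (does ∘ P?) → P x
  ∈-tabulate⁻ {x} x∈ = witness (trans (sym (lookup∘tabulate (does ∘ P?) x)) ([]=⇒lookup x∈))

module IncidenceHypergraph {A B : Set} {P : A → Set} {Q : B → Set}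
         (vertices : Enumeration P) (edges : Enumeration Q)
         (Incident : A → B → Set) (Incident? : ∀ a b → Dec (Incident a b))
         (edge-nonempty : ∀ {b} → Q b → ∃ λ a → P a × Incident a b) where

  private
    module Vs = Enumeration vertices
    module Es = Enumeration edges

  hypergraph : Hypergraph
  hypergraph = record
    { nV = Vs.size
    ; nE = Es.size
    ; edge = λ c → tabulate (λ d → does (Incident? (Vs.elem d) (Es.elem c)))
    ; edge≢∅ = nonempty
    }
    where
    nonempty : ∀ c → ∃ λ d → d ∈ tabulate (λ d → does (Incident? (Vs.elem d) (Es.elem c)))
    nonempty c =
      let a , pa , a~b = edge-nonempty (Es.elem-satisfies c)
          d , elem≡a = Vs.elem-surjective pa
      in d , ∈-tabulate⁺ (λ d → Incident? (Vs.elem d) (Es.elem c)) (subst (λ a → Incident a _) (sym elem≡a) a~b)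

  record CoveringMap (H : Hypergraph) : Set where
    field
      φ : A → Fin (nV H)
      ψ : B → Fin (nE H)
      φ-surjective   : ∀ x → ∃ λ a → P a × φ a ≡ x
      φ-injective-on : ∀ {a₁ a₂ b} → P a₁ → P a₂ → Q b →
                       Incident a₁ b → Incident a₂ b → φ a₁ ≡ φ a₂ → a₁ ≡ a₂
      φ-incident     : ∀ {a b} → Incident a b → φ a ∈ edge H (ψ b)
      φ-onto-edge    : ∀ {b x} → Q b → x ∈ edge H (ψ b) → ∃ λ a → P a × Incident a b × φ a ≡ x
      ψ-injective-at : ∀ {a b₁ b₂} → P a → Q b₁ → Q b₂ →
                       Incident a b₁ → Incident a b₂ → ψ b₁ ≡ ψ b₂ → b₁ ≡ b₂
      ψ-onto-star    : ∀ {a e} → P a → φ a ∈ edge H e → ∃ λ b → Q b × Incident a b × ψ b ≡ e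

  covers : ∀ {H} → CoveringMap H → Covers hypergraph H
  covers {H} m = record
    { φ = φ ∘ Vs.elem
    ; ψ = ψ ∘ Es.elem
    ; φ-surj = λ x → let a , pa , φa≡x = φ-surjective x ; d , elem≡a = Vs.elem-surjective pa
                     in d , λ { refl → trans (cong φ elem≡a) φa≡x }
    ; φ-inj-on = λ c d₁ d₂ d₁∈c d₂∈c eq → Vs.elem-injective
        (φ-injective-on (Vs.elem-satisfies d₁) (Vs.elem-satisfies d₂) (Es.elem-satisfies c)
                        (incident⁻ d₁∈c) (incident⁻ d₂∈c) eq)
    ; φ-image₁ = λ c d d∈c → φ-incident (incident⁻ d∈c)
    ; φ-image₂ = λ c x x∈ψc → let a , pa , a~b , φa≡x = φ-onto-edge (Es.elem-satisfies c) x∈ψc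
                                  d , elem≡a = Vs.elem-surjective pa
                              in d , incident⁺ (subst (λ a → Incident a _) (sym elem≡a) a~b) ,
                                 trans (cong φ elem≡a) φa≡x
    ; ψ-inj-at = λ d c₁ c₂ d∈c₁ d∈c₂ eq → Es.elem-injective
        (ψ-injective-at (Vs.elem-satisfies d) (Es.elem-satisfies c₁) (Es.elem-satisfies c₂)
                        (incident⁻ d∈c₁) (incident⁻ d∈c₂) eq)
    ; ψ-surj-at = λ d e φd∈e → let b , qb , a~b , ψb≡e = ψ-onto-star (Vs.elem-satisfies d) φd∈e
                                   c , elem≡b = Es.elem-surjective qb
                               in c , incident⁺ (subst (Incident _) (sym elem≡b) a~b) ,
                                  trans (cong ψ elem≡b) ψb≡e
    }
    where
    open CoveringMap m
    incident⁻ : ∀ {d c} → d ∈ edge hypergraph c → Incident (Vs.elem d) (Es.elem c)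
    incident⁻ {c = c} = ∈-tabulate⁻ (λ d → Incident? (Vs.elem d) (Es.elem c))
    incident⁺ : ∀ {d c} → Incident (Vs.elem d) (Es.elem c) → d ∈ edge hypergraph c
    incident⁺ {c = c} = ∈-tabulate⁺ (λ d → Incident? (Vs.elem d) (Es.elem c))

module Ranks {H : Hypergraph} {k l : ℕ} {V : Fin k → Fin l → ℕ} {W : Fin l → Fin k → ℕ}
             (C : PerfectColoring H k l V W) where
  open PerfectColoring C public using (f; γ)
  open PerfectColoring C using (surj; γ-distinct; γ-occurs; γ-complete; perfect)

  HasRange : Fin (nE H) → Fin l → Set
  HasRange e j = colorRange H f e ≡ γ j

  HasRange? : ∀ e j → Dec (HasRange e j)
  HasRange? e j = Vec.≡-dec ℕ._≟_ (colorRange H f e) (γ j)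

  range : Fin (nE H) → Fin l
  range e = proj₁ (γ-complete e)

  hasRange : ∀ e → HasRange e (range e)
  hasRange e = proj₂ (γ-complete e)

  range-unique : ∀ {e j} → HasRange e j → range e ≡ j
  range-unique {e} e∶j = γ-distinct (trans (sym (hasRange e)) e∶j)

  representative : ∀ i → ∃ λ x → f x ≡ i
  representative i = let x , fx≡i = surj i in x , fx≡i refl

  private
    edgeOfRange? : ∀ x j e → Dec (x ∈ edge H e × HasRange e j)
    edgeOfRange? x j e = (x ∈? edge H e) ×-dec HasRange? e j

    vertexOfColor? : ∀ e i x → Dec (x ∈ edge H e × f x ≡ i)
    vertexOfColor? e i x = (x ∈? edge H e) ×-dec (f x ≟ i)

  edgeRank : Fin (nV H) → Fin l → Fin (nE H) → ℕ
  edgeRank x j = rank (edgeOfRange? x j)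

  vertexRank : Fin (nE H) → Fin k → Fin (nV H) → ℕ
  vertexRank e i = rank (vertexOfColor? e i)

  private
    count-edges : ∀ {x i} j → f x ≡ i → count (edgeOfRange? x j) ≡ V i j
    count-edges {x} {i} j fx≡i = perfect i j x fx≡i

    count-vertices : ∀ {e j} i → HasRange e j → count (vertexOfColor? e i) ≡ W j i
    count-vertices {e} {j} i e∶j = begin
      count (vertexOfColor? e i) ≡⟨ lookup∘tabulate _ i ⟨
      lookup (colorRange H f e) i                   ≡⟨ cong (λ r → lookup r i) e∶j ⟩
      lookup (γ j) i                                ≡⟨ lookup∘tabulate (W j) i ⟩
      W j i                                         ∎
      where open ≡-Reasoning

  edgeRank-< : ∀ {x i j e} → f x ≡ i → x ∈ edge H e → HasRange e j → edgeRank x j e < V i j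
  edgeRank-< {x} {j = j} {e} fx≡i x∈e e∶j =
    subst (edgeRank x j e <_) (count-edges j fx≡i) (rank<count (edgeOfRange? x j) (x∈e , e∶j))

  edgeRank-injective : ∀ {x j e₁ e₂} → x ∈ edge H e₁ → HasRange e₁ j → x ∈ edge H e₂ → HasRange e₂ j →
                       edgeRank x j e₁ ≡ edgeRank x j e₂ → e₁ ≡ e₂
  edgeRank-injective {x} {j} x∈e₁ e₁∶j x∈e₂ e₂∶j =
    rank-injective (edgeOfRange? x j) (x∈e₁ , e₁∶j) (x∈e₂ , e₂∶j)

  edgeRank-surjective : ∀ {x i j r} → f x ≡ i → r < V i j →
                        ∃ λ e → (x ∈ edge H e × HasRange e j) × edgeRank x j e ≡ r
  edgeRank-surjective {x} {j = j} {r} fx≡i r<V =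
    rank-surjective (edgeOfRange? x j) (subst (r <_) (sym (count-edges j fx≡i)) r<V)

  vertexRank-< : ∀ {x i j e} → f x ≡ i → x ∈ edge H e → HasRange e j → vertexRank e i x < W j i
  vertexRank-< {x} {i} {e = e} fx≡i x∈e e∶j =
    subst (vertexRank e i x <_) (count-vertices i e∶j) (rank<count (vertexOfColor? e i) (x∈e , fx≡i))

  vertexRank-injective : ∀ {e i x₁ x₂} → x₁ ∈ edge H e → f x₁ ≡ i → x₂ ∈ edge H e → f x₂ ≡ i →
                         vertexRank e i x₁ ≡ vertexRank e i x₂ → x₁ ≡ x₂
  vertexRank-injective {e} {i} x₁∈e fx₁≡i x₂∈e fx₂≡i =
    rank-injective (vertexOfColor? e i) (x₁∈e , fx₁≡i) (x₂∈e , fx₂≡i)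

  vertexRank-surjective : ∀ {e i j r} → HasRange e j → r < W j i →
                          ∃ λ x → (x ∈ edge H e × f x ≡ i) × vertexRank e i x ≡ r
  vertexRank-surjective {e} {i} {r = r} e∶j r<W =
    rank-surjective (vertexOfColor? e i) (subst (r <_) (sym (count-vertices i e∶j)) r<W)

  V≤#edges : ∀ i j → V i j ≤ nE H
  V≤#edges i j =
    let x , fx≡i = representative i in subst (_≤ nE H) (count-edges j fx≡i) (count≤ (edgeOfRange? x j))

  W≤#vertices : ∀ j i → W j i ≤ nV H
  W≤#vertices j i =
    let e , e∶j = γ-occurs j in subst (_≤ nV H) (count-vertices i e∶j) (count≤ (vertexOfColor? e i))


module CommonCover (H H′ : Hypergraph) {k l : ℕ} {V : Fin k → Fin l → ℕ} {W : Fin l → Fin k → ℕ}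
                   (C : PerfectColoring H k l V W) (C′ : PerfectColoring H′ k l V W) where

  open Ranks C
  module R′ = Ranks C′
  open States (Fin (nV H)) (Fin (nE H)) (Fin (suc (nE H))) (Fin (suc (nV H))) k l

  private
    ≤pred⇒< : ∀ {s N r} → s ≤ pred N → r < N → s < N
    ≤pred⇒< {N = suc _} s≤ _ = s≤s s≤

    toShift : ∀ {r N B} → r < N → N ≤ B → Fin (suc B)
    toShift r<N N≤B = fromℕ< (s≤s (≤-trans (<⇒≤ r<N) N≤B))

    toℕ-toShift : ∀ {r N B} (r<N : r < N) (N≤B : N ≤ B) → toℕ (toShift r<N N≤B) ≡ r
    toℕ-toShift r<N N≤B = toℕ-fromℕ< (s≤s (≤-trans (<⇒≤ r<N) N≤B))

    toShift-valid : ∀ {r N B} (r<N : r < N) (N≤B : N ≤ B) → toℕ (toShift r<N N≤B) ≤ pred N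
    toShift-valid {N = N} r<N N≤B = subst (_≤ pred N) (sym (toℕ-toShift r<N N≤B)) (<⇒≤pred r<N)

  -- ≤ pred rather than <: a shift modulo 0 still needs a value, and is never used.
  ValidLocal : Fin k → Fin l → Local → Set
  ValidLocal i j (local x e v t) =
    f x ≡ i × HasRange e j × toℕ v ≤ pred (V i j) × toℕ t ≤ pred (W j i)

  -- With a = (x, ε, v, t) the (i, j)-data of a vertex state and b = (y, e, v′, t′) that of an edge state:
  -- x ∈ e lies over x′ ∈ e′ up to the shift v at x and the shift t′ on e, while t numbers y on ε and
  -- v′ numbers ε at y, so that each side's data determines the other's.
  record LocalIncidence (i : Fin k) (j : Fin l) (x′ : Fin (nV H′)) (e′ : Fin (nE H′)) (a b : Local) : Set where
    constructor incidence
    field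
      x′∈e′          : x′ ∈ edge H′ e′
      x∈e            : vertex a ∈ edge H (hyperedge b)
      vshift-aligned : AddMod (V i j) (edgeRank (vertex a) j (hyperedge b)) (toℕ (vertexShift a))
                              (R′.edgeRank x′ j e′)
      eshift-aligned : AddMod (W j i) (vertexRank (hyperedge b) i (vertex a)) (toℕ (edgeShift b))
                              (R′.vertexRank e′ i x′)
      y∈ε            : vertex b ∈ edge H (hyperedge a)
      eshift-locates : vertexRank (hyperedge a) i (vertex b) ≡ toℕ (edgeShift a)
      vshift-locates : edgeRank (vertex b) j (hyperedge a) ≡ toℕ (vertexShift b)

  localIncidence? : ∀ i j x′ e′ a b → Dec (LocalIncidence i j x′ e′ a b)
  localIncidence? i j x′ e′ a b =
    map′ (λ (p₁ , p₂ , p₃ , p₄ , p₅ , p₆ , p₇) → incidence p₁ p₂ p₃ p₄ p₅ p₆ p₇)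
         (λ (incidence p₁ p₂ p₃ p₄ p₅ p₆ p₇) → p₁ , p₂ , p₃ , p₄ , p₅ , p₆ , p₇)
         ((x′ ∈? edge H′ e′) ×-dec (vertex a ∈? edge H (hyperedge b)) ×-dec
          addMod? _ _ _ _ ×-dec addMod? _ _ _ _ ×-dec (vertex b ∈? edge H (hyperedge a)) ×-dec
          (_ ℕ.≟ _) ×-dec (_ ℕ.≟ _))

  complete-edge-side : ∀ {i j x′ e′ e} a → ValidLocal i j a →
                       x′ ∈ edge H′ e′ → R′.f x′ ≡ i → R′.HasRange e′ j → vertex a ∈ edge H e → HasRange e j →
                       AddMod (V i j) (edgeRank (vertex a) j e) (toℕ (vertexShift a)) (R′.edgeRank x′ j e′) →
                       ∃ λ b → ValidLocal i j b × LocalIncidence i j x′ e′ a b × hyperedge b ≡ e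
  complete-edge-side {i} {j} {x′} {e′} {e} (local x ε v t) (fx≡i , ε∶j , _ , t≤)
                     x′∈e′ f′x′≡i e′∶j x∈e e∶j v-aligned =
    let x′-rank<W = R′.vertexRank-< f′x′≡i x′∈e′ e′∶j
        y , (y∈ε , fy≡i) , y-locates = vertexRank-surjective ε∶j (≤pred⇒< t≤ x′-rank<W)
        t′ , t′<W , t′-aligned = addMod-right (vertexRank-< fx≡i x∈e e∶j) x′-rank<W
        v′<V = edgeRank-< fy≡i y∈ε ε∶j
        v′≡ = toℕ-toShift v′<V (V≤#edges i j)
        t′≡ = toℕ-toShift t′<W (W≤#vertices j i)
    in local y e (toShift v′<V (V≤#edges i j)) (toShift t′<W (W≤#vertices j i)) ,
       (fy≡i , e∶j , toShift-valid v′<V (V≤#edges i j) , toShift-valid t′<W (W≤#vertices j i)) ,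
       incidence x′∈e′ x∈e v-aligned (subst (λ s → AddMod (W j i) _ s _) (sym t′≡) t′-aligned)
                 y∈ε y-locates (sym v′≡) ,
       refl

  complete-vertex-side : ∀ {i j x′ e′ x} b → ValidLocal i j b →
                         x′ ∈ edge H′ e′ → R′.f x′ ≡ i → R′.HasRange e′ j → x ∈ edge H (hyperedge b) → f x ≡ i →
                         AddMod (W j i) (vertexRank (hyperedge b) i x) (toℕ (edgeShift b)) (R′.vertexRank e′ i x′) →
                         ∃ λ a → ValidLocal i j a × LocalIncidence i j x′ e′ a b × vertex a ≡ x
  complete-vertex-side {i} {j} {x′} {e′} {x} (local y e v′ t′) (fy≡i , e∶j , v′≤ , _)
                       x′∈e′ f′x′≡i e′∶j x∈e fx≡i t′-aligned =
    let x′-rank<V = R′.edgeRank-< f′x′≡i x′∈e′ e′∶j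
        ε , (y∈ε , ε∶j) , ε-locates = edgeRank-surjective fy≡i (≤pred⇒< v′≤ x′-rank<V)
        v , v<V , v-aligned = addMod-right (edgeRank-< fx≡i x∈e e∶j) x′-rank<V
        t<W = vertexRank-< fy≡i y∈ε ε∶j
        v≡ = toℕ-toShift v<V (V≤#edges i j)
        t≡ = toℕ-toShift t<W (W≤#vertices j i)
    in local x ε (toShift v<V (V≤#edges i j)) (toShift t<W (W≤#vertices j i)) ,
       (fx≡i , ε∶j , toShift-valid v<V (V≤#edges i j) , toShift-valid t<W (W≤#vertices j i)) ,
       incidence x′∈e′ x∈e (subst (λ s → AddMod (V i j) _ s _) (sym v≡) v-aligned) t′-aligned
                 y∈ε (sym t≡) ε-locates ,
       refl

  local-edge-over-H′ : ∀ {i j x′ e′} a → ValidLocal i j a → x′ ∈ edge H′ e′ → R′.f x′ ≡ i → R′.HasRange e′ j →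
                       ∃ λ b → ValidLocal i j b × LocalIncidence i j x′ e′ a b
  local-edge-over-H′ a@(local x ε v t) valid-a@(fx≡i , _ , v≤ , _) x′∈e′ f′x′≡i e′∶j =
    let x′-rank<V = R′.edgeRank-< f′x′≡i x′∈e′ e′∶j
        p , p<V , p-aligned = addMod-left (≤pred⇒< v≤ x′-rank<V) x′-rank<V
        e , (x∈e , e∶j) , x-rank≡p = edgeRank-surjective fx≡i p<V
        b , valid-b , a~b , _ = complete-edge-side a valid-a x′∈e′ f′x′≡i e′∶j x∈e e∶j
                                  (subst (λ p → AddMod _ p _ _) (sym x-rank≡p) p-aligned)
    in b , valid-b , a~b

  local-edge-over-H : ∀ {i j x′ e} a → ValidLocal i j a → vertex a ∈ edge H e → HasRange e j → R′.f x′ ≡ i →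
                      ∃ λ e′ → R′.HasRange e′ j ×
                               ∃ λ b → ValidLocal i j b × LocalIncidence i j x′ e′ a b × hyperedge b ≡ e
  local-edge-over-H a@(local x ε v t) valid-a@(fx≡i , _ , v≤ , _) x∈e e∶j f′x′≡i =
    let x-rank<V = edgeRank-< fx≡i x∈e e∶j
        q , q<V , q-aligned = addMod-sum x-rank<V (≤pred⇒< v≤ x-rank<V)
        e′ , (x′∈e′ , e′∶j) , x′-rank≡q = R′.edgeRank-surjective f′x′≡i q<V
    in e′ , e′∶j ,
       complete-edge-side a valid-a x′∈e′ f′x′≡i e′∶j x∈e e∶j (subst (AddMod _ _ _) (sym x′-rank≡q) q-aligned)

  local-vertex-over-H′ : ∀ {i j x′ e′} b → ValidLocal i j b → x′ ∈ edge H′ e′ → R′.f x′ ≡ i → R′.HasRange e′ j →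
                         ∃ λ a → ValidLocal i j a × LocalIncidence i j x′ e′ a b
  local-vertex-over-H′ b@(local y e v′ t′) valid-b@(_ , e∶j , _ , t′≤) x′∈e′ f′x′≡i e′∶j =
    let x′-rank<W = R′.vertexRank-< f′x′≡i x′∈e′ e′∶j
        p , p<W , p-aligned = addMod-left (≤pred⇒< t′≤ x′-rank<W) x′-rank<W
        x , (x∈e , fx≡i) , x-rank≡p = vertexRank-surjective e∶j p<W
        a , valid-a , a~b , _ = complete-vertex-side b valid-b x′∈e′ f′x′≡i e′∶j x∈e fx≡i
                                  (subst (λ p → AddMod _ p _ _) (sym x-rank≡p) p-aligned)
    in a , valid-a , a~b

  local-vertex-over-H : ∀ {i j e′ x} b → ValidLocal i j b → x ∈ edge H (hyperedge b) → f x ≡ i →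
                        R′.HasRange e′ j →
                        ∃ λ x′ → R′.f x′ ≡ i × ∃ λ a → ValidLocal i j a × LocalIncidence i j x′ e′ a b × vertex a ≡ x
  local-vertex-over-H b@(local y e v′ t′) valid-b@(_ , e∶j , _ , t′≤) x∈e fx≡i e′∶j =
    let x-rank<W = vertexRank-< fx≡i x∈e e∶j
        q , q<W , q-aligned = addMod-sum x-rank<W (≤pred⇒< t′≤ x-rank<W)
        x′ , (x′∈e′ , f′x′≡i) , x′-rank≡q = R′.vertexRank-surjective e′∶j q<W
    in x′ , f′x′≡i ,
       complete-vertex-side b valid-b x′∈e′ f′x′≡i e′∶j x∈e fx≡i (subst (AddMod _ _ _) (sym x′-rank≡q) q-aligned)

  H′-edge-determined : ∀ {i j x′ e₁′ e₂′ a b₁ b₂} → R′.f x′ ≡ i → R′.HasRange e₁′ j → R′.HasRange e₂′ j →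
                       LocalIncidence i j x′ e₁′ a b₁ → LocalIncidence i j x′ e₂′ a b₂ →
                       hyperedge b₁ ≡ hyperedge b₂ → e₁′ ≡ e₂′
  H′-edge-determined f′x′≡i e₁′∶j e₂′∶j I₁ I₂ e₁≡e₂ =
    R′.edgeRank-injective I₁.x′∈e′ e₁′∶j I₂.x′∈e′ e₂′∶j
      (addMod-sum-unique (R′.edgeRank-< f′x′≡i I₁.x′∈e′ e₁′∶j) (R′.edgeRank-< f′x′≡i I₂.x′∈e′ e₂′∶j)
        I₁.vshift-aligned (subst (λ e → AddMod _ (edgeRank _ _ e) _ _) (sym e₁≡e₂) I₂.vshift-aligned))
    where
    module I₁ = LocalIncidence I₁
    module I₂ = LocalIncidence I₂

  H-edge-determined : ∀ {i j x′ e′ a b₁ b₂} → ValidLocal i j a → ValidLocal i j b₁ → ValidLocal i j b₂ →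
                      LocalIncidence i j x′ e′ a b₁ → LocalIncidence i j x′ e′ a b₂ → hyperedge b₁ ≡ hyperedge b₂
  H-edge-determined {a = local _ _ _ _} {local _ _ _ _} {local _ _ _ _} (fx≡i , _) (_ , e₁∶j , _) (_ , e₂∶j , _)
                    I₁ I₂ =
    edgeRank-injective I₁.x∈e e₁∶j I₂.x∈e e₂∶j
      (addMod-left-unique (edgeRank-< fx≡i I₁.x∈e e₁∶j) (edgeRank-< fx≡i I₂.x∈e e₂∶j)
                          I₁.vshift-aligned I₂.vshift-aligned)
    where
    module I₁ = LocalIncidence I₁
    module I₂ = LocalIncidence I₂

  edge-local-determined : ∀ {i j x′ e′ a b₁ b₂} → R′.f x′ ≡ i → R′.HasRange e′ j →
                          ValidLocal i j b₁ → ValidLocal i j b₂ →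
                          LocalIncidence i j x′ e′ a b₁ → LocalIncidence i j x′ e′ a b₂ →
                          hyperedge b₁ ≡ hyperedge b₂ → b₁ ≡ b₂
  edge-local-determined {i} {j} {a = local x ε v t} {local y₁ e _ _} {local y₂ _ _ _}
                        f′x′≡i e′∶j (fy₁≡i , _ , _ , t₁′≤) (fy₂≡i , _ , _ , t₂′≤) I₁ I₂ refl =
    cong₄ local y₁≡y₂ refl (toℕ-injective v′-eq) (toℕ-injective t′-eq)
    where
    module I₁ = LocalIncidence I₁
    module I₂ = LocalIncidence I₂
    y₁≡y₂ = vertexRank-injective I₁.y∈ε fy₁≡i I₂.y∈ε fy₂≡i (trans I₁.eshift-locates (sym I₂.eshift-locates))
    v′-eq = trans (sym I₁.vshift-locates) (trans (cong (λ y → edgeRank y j ε) y₁≡y₂) I₂.vshift-locates)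
    x′-rank<W = R′.vertexRank-< f′x′≡i I₁.x′∈e′ e′∶j
    t′-eq = addMod-right-unique (≤pred⇒< t₁′≤ x′-rank<W) (≤pred⇒< t₂′≤ x′-rank<W)
                                I₁.eshift-aligned I₂.eshift-aligned

  H′-vertex-determined : ∀ {i j x₁′ x₂′ e′ a₁ a₂ b} → R′.f x₁′ ≡ i → R′.f x₂′ ≡ i → R′.HasRange e′ j →
                         LocalIncidence i j x₁′ e′ a₁ b → LocalIncidence i j x₂′ e′ a₂ b →
                         vertex a₁ ≡ vertex a₂ → x₁′ ≡ x₂′
  H′-vertex-determined f′x₁′≡i f′x₂′≡i e′∶j I₁ I₂ x₁≡x₂ =
    R′.vertexRank-injective I₁.x′∈e′ f′x₁′≡i I₂.x′∈e′ f′x₂′≡i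
      (addMod-sum-unique (R′.vertexRank-< f′x₁′≡i I₁.x′∈e′ e′∶j) (R′.vertexRank-< f′x₂′≡i I₂.x′∈e′ e′∶j)
        I₁.eshift-aligned (subst (λ x → AddMod _ (vertexRank _ _ x) _ _) (sym x₁≡x₂) I₂.eshift-aligned))
    where
    module I₁ = LocalIncidence I₁
    module I₂ = LocalIncidence I₂

  H-vertex-determined : ∀ {i j x′ e′ a₁ a₂ b} → ValidLocal i j a₁ → ValidLocal i j a₂ → ValidLocal i j b →
                        LocalIncidence i j x′ e′ a₁ b → LocalIncidence i j x′ e′ a₂ b → vertex a₁ ≡ vertex a₂
  H-vertex-determined {a₁ = local _ _ _ _} {local _ _ _ _} {local _ _ _ _} (fx₁≡i , _) (fx₂≡i , _) (_ , e∶j , _)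
                      I₁ I₂ =
    vertexRank-injective I₁.x∈e fx₁≡i I₂.x∈e fx₂≡i
      (addMod-left-unique (vertexRank-< fx₁≡i I₁.x∈e e∶j) (vertexRank-< fx₂≡i I₂.x∈e e∶j)
                          I₁.eshift-aligned I₂.eshift-aligned)
    where
    module I₁ = LocalIncidence I₁
    module I₂ = LocalIncidence I₂

  vertex-local-determined : ∀ {i j x′ e′ a₁ a₂ b} → R′.f x′ ≡ i → R′.HasRange e′ j →
                            ValidLocal i j a₁ → ValidLocal i j a₂ →
                            LocalIncidence i j x′ e′ a₁ b → LocalIncidence i j x′ e′ a₂ b →
                            vertex a₁ ≡ vertex a₂ → a₁ ≡ a₂
  vertex-local-determined {i} {j} {a₁ = local x ε₁ _ _} {local _ ε₂ _ _} {local y e v′ t′}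
                          f′x′≡i e′∶j (_ , ε₁∶j , v₁≤ , _) (_ , ε₂∶j , v₂≤ , _) I₁ I₂ refl =
    cong₄ local refl ε₁≡ε₂ (toℕ-injective v-eq) (toℕ-injective t-eq)
    where
    module I₁ = LocalIncidence I₁
    module I₂ = LocalIncidence I₂
    ε₁≡ε₂ = edgeRank-injective I₁.y∈ε ε₁∶j I₂.y∈ε ε₂∶j (trans I₁.vshift-locates (sym I₂.vshift-locates))
    t-eq = trans (sym I₁.eshift-locates) (trans (cong (λ ε → vertexRank ε i y) ε₁≡ε₂) I₂.eshift-locates)
    x′-rank<V = R′.edgeRank-< f′x′≡i I₁.x′∈e′ e′∶j
    v-eq = addMod-right-unique (≤pred⇒< v₁≤ x′-rank<V) (≤pred⇒< v₂≤ x′-rank<V)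
                               I₁.vshift-aligned I₂.vshift-aligned

  Valid : State → Set
  Valid (state xs es vs ts) =
    (∀ i → f (lookup xs i) ≡ i) × (∀ j → HasRange (lookup es j) j) ×
    (∀ i j → toℕ (vs ⟦ i , j ⟧) ≤ pred (V i j)) × (∀ i j → toℕ (ts ⟦ i , j ⟧) ≤ pred (W j i))

  valid? : ∀ ω → Dec (Valid ω)
  valid? (state xs es vs ts) =
    all? (λ i → f (lookup xs i) ≟ i) ×-dec all? (λ j → HasRange? (lookup es j) j) ×-dec
    all? (λ i → all? λ j → toℕ (vs ⟦ i , j ⟧) ℕ.≤? pred (V i j)) ×-dec
    all? (λ i → all? λ j → toℕ (ts ⟦ i , j ⟧) ℕ.≤? pred (W j i))

  valid-local : ∀ ω i j → Valid ω → ValidLocal i j (ω ⟨ i , j ⟩)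
  valid-local (state _ _ _ _) i j (xs-ok , es-ok , vs-ok , ts-ok) = xs-ok i , es-ok j , vs-ok i j , ts-ok i j

  valid-update : ∀ ω i j c → Valid ω → ValidLocal i j c → Valid (ω ⟨ i , j ⟩≔ c)
  valid-update (state xs es vs ts) i j (local _ _ _ _) (xs-ok , es-ok , vs-ok , ts-ok)
               (fx≡i , e∶j , v≤ , t≤) =
    update-preserves {P = λ i x → f x ≡ i} xs xs-ok fx≡i ,
    update-preserves {P = λ j e → HasRange e j} es es-ok e∶j ,
    update-preserves₂ {P = λ i j v → toℕ v ≤ pred (V i j)} vs vs-ok v≤ ,
    update-preserves₂ {P = λ i j t → toℕ t ≤ pred (W j i)} ts ts-ok t≤

  private
    zeroShifts : ∀ {B} → Matrix (Fin (suc B)) k l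
    zeroShifts = replicate k (replicate l zero)

    zeroShifts-lookup : ∀ {B} i j → zeroShifts {B} ⟦ i , j ⟧ ≡ zero
    zeroShifts-lookup i j = trans (cong (λ row → lookup row j) (lookup-replicate i _)) (lookup-replicate j zero)

    representatives : Vec (Fin (nV H)) k
    representatives = tabulate (proj₁ ∘ representative)

  anchored : Fin (nV H) → State
  anchored x = state (representatives [ f x ]≔ x) (tabulate (proj₁ ∘ γ-occurs)) zeroShifts zeroShifts
    where open PerfectColoring C using (γ-occurs)

  anchored-vertex : ∀ x → lookup (vertices (anchored x)) (f x) ≡ x
  anchored-vertex x = lookup∘update (f x) representatives x

  anchored-valid : ∀ x → Valid (anchored x)
  anchored-valid x =
    update-preserves {P = λ i x → f x ≡ i} representatives
      (λ i → trans (cong f (lookup∘tabulate _ i)) (proj₂ (representative i))) refl ,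
    (λ j → subst (λ e → HasRange e j) (sym (lookup∘tabulate _ j)) (proj₂ (γ-occurs j))) ,
    (λ i j → subst (λ s → toℕ s ≤ pred (V i j)) (sym (zeroShifts-lookup i j)) z≤n) ,
    (λ i j → subst (λ s → toℕ s ≤ pred (W j i)) (sym (zeroShifts-lookup i j)) z≤n)
    where open PerfectColoring C using (γ-occurs)

  Vertex : Set
  Vertex = Fin (nV H′) × State

  Edge : Set
  Edge = Fin (nE H′) × State

  states-finite : Finite State
  states-finite = State-finite Fin-finite Fin-finite Fin-finite Fin-finite

  IncidentAt : Fin k → Fin l → Vertex → Edge → Set
  IncidentAt i j (x′ , ω) (e′ , ω′) = Adjacent i j ω ω′ × LocalIncidence i j x′ e′ (ω ⟨ i , j ⟩) (ω′ ⟨ i , j ⟩)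

  Incident : Vertex → Edge → Set
  Incident (x′ , ω) (e′ , ω′) = IncidentAt (R′.f x′) (R′.range e′) (x′ , ω) (e′ , ω′)

  incident? : ∀ v e → Dec (Incident v e)
  incident? (x′ , ω) (e′ , ω′) = finite⇒≡-dec states-finite _ _ ×-dec localIncidence? _ _ x′ e′ _ _

  incident-at : ∀ {x′ ω e′ ω′ i j} → Incident (x′ , ω) (e′ , ω′) → R′.f x′ ≡ i → R′.range e′ ≡ j →
                IncidentAt i j (x′ , ω) (e′ , ω′)
  incident-at I refl refl = I

  incident-via-edge : ∀ {x′ ω e′ i j b} → R′.f x′ ≡ i → R′.range e′ ≡ j →
                      LocalIncidence i j x′ e′ (ω ⟨ i , j ⟩) b → Incident (x′ , ω) (e′ , ω ⟨ i , j ⟩≔ b)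
  incident-via-edge {x′} {ω} {e′} {i} {j} {b} refl refl a~b =
    adjacent-update i j ω b , subst (LocalIncidence i j x′ e′ (ω ⟨ i , j ⟩)) (sym (local∘update i j ω b)) a~b

  incident-via-vertex : ∀ {x′ e′ ω′ i j a} → R′.f x′ ≡ i → R′.range e′ ≡ j →
                        LocalIncidence i j x′ e′ a (ω′ ⟨ i , j ⟩) → Incident (x′ , ω′ ⟨ i , j ⟩≔ a) (e′ , ω′)
  incident-via-vertex {x′} {e′} {ω′} {i} {j} {a} refl refl a~b =
    adjacent-sym i j (adjacent-update i j ω′ a) ,
    subst (λ a → LocalIncidence i j x′ e′ a (ω′ ⟨ i , j ⟩)) (sym (local∘update i j ω′ a)) a~b

  edge-determined-at : ∀ {x′ ω e′ ω₁ ω₂} → Valid ω₁ → Valid ω₂ →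
                       Incident (x′ , ω) (e′ , ω₁) → Incident (x′ , ω) (e′ , ω₂) →
                       lookup (hyperedges ω₁) (R′.range e′) ≡ lookup (hyperedges ω₂) (R′.range e′) → ω₁ ≡ ω₂
  edge-determined-at {x′} {e′ = e′} {ω₁} {ω₂} valid₁ valid₂ (ω~ω₁ , a~b₁) (ω~ω₂ , a~b₂) e₁≡e₂ =
    adjacent-unique i j ω~ω₁ ω~ω₂
      (edge-local-determined refl (R′.hasRange e′) (valid-local ω₁ i j valid₁) (valid-local ω₂ i j valid₂)
                             a~b₁ a~b₂ e₁≡e₂)
    where
    i = R′.f x′
    j = R′.range e′

  vertex-determined-in : ∀ {x′ ω₁ ω₂ e′ ω′} → Valid ω₁ → Valid ω₂ →
                         Incident (x′ , ω₁) (e′ , ω′) → Incident (x′ , ω₂) (e′ , ω′) →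
                         lookup (vertices ω₁) (R′.f x′) ≡ lookup (vertices ω₂) (R′.f x′) → ω₁ ≡ ω₂
  vertex-determined-in {x′} {ω₁} {ω₂} {e′} valid₁ valid₂ (ω₁~ω′ , a₁~b) (ω₂~ω′ , a₂~b) x₁≡x₂ =
    adjacent-unique i j (adjacent-sym i j ω₁~ω′) (adjacent-sym i j ω₂~ω′)
      (vertex-local-determined refl (R′.hasRange e′) (valid-local ω₁ i j valid₁) (valid-local ω₂ i j valid₂)
                               a₁~b a₂~b x₁≡x₂)
    where
    i = R′.f x′
    j = R′.range e′

  vertexInH′ : Vertex → Fin (nV H′)
  vertexInH′ = proj₁

  edgeInH′ : Edge → Fin (nE H′)
  edgeInH′ = proj₁

  vertexInH : Vertex → Fin (nV H)
  vertexInH (x′ , ω) = lookup (vertices ω) (R′.f x′)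

  edgeInH : Edge → Fin (nE H)
  edgeInH (e′ , ω′) = lookup (hyperedges ω′) (R′.range e′)

  vertexInH′-surjective : ∀ x′ → ∃ λ v → Valid (proj₂ v) × vertexInH′ v ≡ x′
  vertexInH′-surjective x′ = let x , _ = representative (R′.f x′) in (x′ , anchored x) , anchored-valid x , refl

  vertexInH′-injective-on : ∀ {v₁ v₂ b} → Valid (proj₂ v₁) → Valid (proj₂ v₂) → Valid (proj₂ b) →
                            Incident v₁ b → Incident v₂ b → vertexInH′ v₁ ≡ vertexInH′ v₂ → v₁ ≡ v₂
  vertexInH′-injective-on {x′ , ω₁} {_ , ω₂} {e′ , ω′} valid₁ valid₂ valid′ I₁ I₂ refl =
    cong (x′ ,_) (vertex-determined-in valid₁ valid₂ I₁ I₂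
      (H-vertex-determined (valid-local ω₁ i j valid₁) (valid-local ω₂ i j valid₂) (valid-local ω′ i j valid′)
                           (proj₂ I₁) (proj₂ I₂)))
    where
    i = R′.f x′
    j = R′.range e′

  vertexInH′-onto-edge : ∀ {b x′} → Valid (proj₂ b) → x′ ∈ edge H′ (edgeInH′ b) →
                         ∃ λ v → Valid (proj₂ v) × Incident v b × vertexInH′ v ≡ x′
  vertexInH′-onto-edge {e′ , ω′} {x′} valid′ x′∈e′ =
    lift (local-vertex-over-H′ (ω′ ⟨ i , j ⟩) (valid-local ω′ i j valid′) x′∈e′ refl (R′.hasRange e′))
    where
    i = R′.f x′
    j = R′.range e′
    lift : (∃ λ a → ValidLocal i j a × LocalIncidence i j x′ e′ a (ω′ ⟨ i , j ⟩)) →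
           ∃ λ v → Valid (proj₂ v) × Incident v (e′ , ω′) × vertexInH′ v ≡ x′
    lift (a , valid-a , a~b) =
      (x′ , ω′ ⟨ i , j ⟩≔ a) , valid-update ω′ i j a valid′ valid-a ,
      incident-via-vertex {ω′ = ω′} refl refl a~b , refl

  edgeInH′-injective-at : ∀ {v b₁ b₂} → Valid (proj₂ v) → Valid (proj₂ b₁) → Valid (proj₂ b₂) →
                          Incident v b₁ → Incident v b₂ → edgeInH′ b₁ ≡ edgeInH′ b₂ → b₁ ≡ b₂
  edgeInH′-injective-at {x′ , ω} {e′ , ω₁} {_ , ω₂} valid valid₁ valid₂ I₁ I₂ refl =
    cong (e′ ,_) (edge-determined-at valid₁ valid₂ I₁ I₂
      (H-edge-determined (valid-local ω i j valid) (valid-local ω₁ i j valid₁) (valid-local ω₂ i j valid₂)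
                         (proj₂ I₁) (proj₂ I₂)))
    where
    i = R′.f x′
    j = R′.range e′

  edgeInH′-onto-star : ∀ {v e′} → Valid (proj₂ v) → vertexInH′ v ∈ edge H′ e′ →
                       ∃ λ b → Valid (proj₂ b) × Incident v b × edgeInH′ b ≡ e′
  edgeInH′-onto-star {x′ , ω} {e′} valid x′∈e′ =
    lift (local-edge-over-H′ (ω ⟨ i , j ⟩) (valid-local ω i j valid) x′∈e′ refl (R′.hasRange e′))
    where
    i = R′.f x′
    j = R′.range e′
    lift : (∃ λ b → ValidLocal i j b × LocalIncidence i j x′ e′ (ω ⟨ i , j ⟩) b) →
           ∃ λ b → Valid (proj₂ b) × Incident (x′ , ω) b × edgeInH′ b ≡ e′
    lift (b , valid-b , a~b) =
      (e′ , ω ⟨ i , j ⟩≔ b) , valid-update ω i j b valid valid-b , incident-via-edge {ω = ω} refl refl a~b , refl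

  vertexInH-surjective : ∀ x → ∃ λ v → Valid (proj₂ v) × vertexInH v ≡ x
  vertexInH-surjective x =
    let x′ , f′x′≡fx = R′.representative (f x)
    in (x′ , anchored x) , anchored-valid x ,
       trans (cong (lookup (vertices (anchored x))) f′x′≡fx) (anchored-vertex x)

  vertexInH-injective-on : ∀ {v₁ v₂ b} → Valid (proj₂ v₁) → Valid (proj₂ v₂) → Valid (proj₂ b) →
                           Incident v₁ b → Incident v₂ b → vertexInH v₁ ≡ vertexInH v₂ → v₁ ≡ v₂
  vertexInH-injective-on {x₁′ , ω₁} {x₂′ , ω₂} {e′ , ω′} valid₁ valid₂ _ I₁ I₂ x₁≡x₂ =
    cong₂ _,_ x₁′≡x₂′
      (vertex-determined-in valid₁ valid₂ I₁ (subst (λ x′ → Incident (x′ , ω₂) (e′ , ω′)) (sym x₁′≡x₂′) I₂) x₁≡x₂′)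
    where
    i = R′.f x₁′
    colors≡ : R′.f x₂′ ≡ i
    colors≡ = trans (sym (proj₁ valid₂ (R′.f x₂′))) (trans (cong f (sym x₁≡x₂)) (proj₁ valid₁ i))
    x₁≡x₂′ : lookup (vertices ω₁) i ≡ lookup (vertices ω₂) i
    x₁≡x₂′ = trans x₁≡x₂ (cong (lookup (vertices ω₂)) colors≡)
    x₁′≡x₂′ : x₁′ ≡ x₂′
    x₁′≡x₂′ = H′-vertex-determined refl colors≡ (R′.hasRange e′)
                                   (proj₂ I₁) (proj₂ (incident-at I₂ colors≡ refl)) x₁≡x₂′

  vertexInH-onto-edge : ∀ {b x} → Valid (proj₂ b) → x ∈ edge H (edgeInH b) →
                        ∃ λ v → Valid (proj₂ v) × Incident v b × vertexInH v ≡ x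
  vertexInH-onto-edge {e′ , ω′} {x} valid′ x∈e =
    lift (local-vertex-over-H (ω′ ⟨ i , j ⟩) (valid-local ω′ i j valid′) x∈e refl (R′.hasRange e′))
    where
    i = f x
    j = R′.range e′
    lift : (∃ λ x′ → R′.f x′ ≡ i ×
                     ∃ λ a → ValidLocal i j a × LocalIncidence i j x′ e′ a (ω′ ⟨ i , j ⟩) × vertex a ≡ x) →
           ∃ λ v → Valid (proj₂ v) × Incident v (e′ , ω′) × vertexInH v ≡ x
    lift (x′ , f′x′≡i , a , valid-a , a~b , a≡x) =
      (x′ , ω′ ⟨ i , j ⟩≔ a) , valid-update ω′ i j a valid′ valid-a , incident-via-vertex {ω′ = ω′} f′x′≡i refl a~b ,
      trans (cong (lookup (vertices (ω′ ⟨ i , j ⟩≔ a))) f′x′≡i) (trans (cong vertex (local∘update i j ω′ a)) a≡x)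

  edgeInH-injective-at : ∀ {v b₁ b₂} → Valid (proj₂ v) → Valid (proj₂ b₁) → Valid (proj₂ b₂) →
                         Incident v b₁ → Incident v b₂ → edgeInH b₁ ≡ edgeInH b₂ → b₁ ≡ b₂
  edgeInH-injective-at {x′ , ω} {e₁′ , ω₁} {e₂′ , ω₂} _ valid₁ valid₂ I₁ I₂ e₁≡e₂ =
    cong₂ _,_ e₁′≡e₂′
      (edge-determined-at valid₁ valid₂ I₁ (subst (λ e′ → Incident (x′ , ω) (e′ , ω₂)) (sym e₁′≡e₂′) I₂) e₁≡e₂′)
    where
    j = R′.range e₁′
    ranges≡ : R′.range e₂′ ≡ j
    ranges≡ = trans (sym (range-unique (proj₁ (proj₂ valid₂) (R′.range e₂′))))
                    (range-unique (subst (λ e → HasRange e j) e₁≡e₂ (proj₁ (proj₂ valid₁) j)))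
    e₁≡e₂′ : lookup (hyperedges ω₁) j ≡ lookup (hyperedges ω₂) j
    e₁≡e₂′ = trans e₁≡e₂ (cong (lookup (hyperedges ω₂)) ranges≡)
    e₁′≡e₂′ : e₁′ ≡ e₂′
    e₁′≡e₂′ = H′-edge-determined refl (R′.hasRange e₁′) (subst (R′.HasRange e₂′) ranges≡ (R′.hasRange e₂′))
                (proj₂ I₁) (proj₂ (incident-at I₂ refl ranges≡)) e₁≡e₂′

  edgeInH-onto-star : ∀ {v e} → Valid (proj₂ v) → vertexInH v ∈ edge H e →
                      ∃ λ b → Valid (proj₂ b) × Incident v b × edgeInH b ≡ e
  edgeInH-onto-star {x′ , ω} {e} valid x∈e =
    lift (local-edge-over-H (ω ⟨ i , j ⟩) (valid-local ω i j valid) x∈e (hasRange e) refl)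
    where
    i = R′.f x′
    j = range e
    lift : (∃ λ e′ → R′.HasRange e′ j ×
                     ∃ λ b → ValidLocal i j b × LocalIncidence i j x′ e′ (ω ⟨ i , j ⟩) b × hyperedge b ≡ e) →
           ∃ λ b → Valid (proj₂ b) × Incident (x′ , ω) b × edgeInH b ≡ e
    lift (e′ , e′∶j , b , valid-b , a~b , b≡e) =
      (e′ , ω ⟨ i , j ⟩≔ b) , valid-update ω i j b valid valid-b ,
      incident-via-edge {ω = ω} refl (R′.range-unique e′∶j) a~b ,
      trans (cong (lookup (hyperedges (ω ⟨ i , j ⟩≔ b))) (R′.range-unique e′∶j))
            (trans (cong hyperedge (local∘update i j ω b)) b≡e)

  private
    vertexEnumeration : Enumeration (Valid ∘ proj₂ {B = λ (_ : Fin (nV H′)) → State})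
    vertexEnumeration = enumerate (×-finite Fin-finite states-finite) (valid? ∘ proj₂)

    edgeEnumeration : Enumeration (Valid ∘ proj₂ {B = λ (_ : Fin (nE H′)) → State})
    edgeEnumeration = enumerate (×-finite Fin-finite states-finite) (valid? ∘ proj₂)

    edge-nonempty : ∀ {b} → Valid (proj₂ b) → ∃ λ v → Valid (proj₂ v) × Incident v b
    edge-nonempty {e′ , _} valid′ =
      let x′ , x′∈e′ = edge≢∅ H′ e′
          v , valid-v , v~b , _ = vertexInH′-onto-edge valid′ x′∈e′
      in v , valid-v , v~b

  open IncidenceHypergraph vertexEnumeration edgeEnumeration Incident incident? edge-nonempty public

  covering-H′ : CoveringMap H′
  covering-H′ = record
    { φ = vertexInH′
    ; ψ = edgeInH′
    ; φ-surjective = vertexInH′-surjective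
    ; φ-injective-on = vertexInH′-injective-on
    ; φ-incident = λ (_ , a~b) → LocalIncidence.x′∈e′ a~b
    ; φ-onto-edge = vertexInH′-onto-edge
    ; ψ-injective-at = edgeInH′-injective-at
    ; ψ-onto-star = edgeInH′-onto-star
    }

  covering-H : CoveringMap H
  covering-H = record
    { φ = vertexInH
    ; ψ = edgeInH
    ; φ-surjective = vertexInH-surjective
    ; φ-injective-on = vertexInH-injective-on
    ; φ-incident = λ (_ , a~b) → LocalIncidence.x∈e a~b
    ; φ-onto-edge = vertexInH-onto-edge
    ; ψ-injective-at = edgeInH-injective-at
    ; ψ-onto-star = edgeInH-onto-star
    }

theorem12 : (H H′ : Hypergraph) → Connected H → Connected H′ →
            (k l : ℕ) (V : Fin k → Fin l → ℕ) (W : Fin l → Fin k → ℕ) →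
            PerfectColoring H k l V W → PerfectColoring H′ k l V W →
            ∃ λ (G : Hypergraph) → Covers G H × Covers G H′
theorem12 H H′ _ _ k l V W C C′ = hypergraph , covers covering-H , covers covering-H′
  where open CommonCover H H′ C C′
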